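{- Let $q$ be a prime number and let $\omega_q=w_0w_1w_2\cdots$ be the generalized Thue-Morse word over $\Sigma_q=\{0,\dots,q-1\}$, $w_i=s_q(i)$. Let $n\ge1$ with $n\equiv 0\pmod q$, $d=q^n-1$, $y=q^n-(q-1)$, $x=q-1$, and for a non-negative integer $z$ put $c=c(z)=z\,q^{2n}+y\,q^n+x$. Then $\max_{z\ge 0} L_{\omega_q}(c(z),d)=q^n+2q$.
   Context: $s_q(i)$ is the sum modulo $q$ of the digits of the base-$q$ expansion of $i$. For $c\ge 0$, $d\ge 1$, $L_{\omega_q}(c,d)$ is the largest $k\ge1$ such that $w_c=w_{c+d}=\cdots=w_{c+(k-1)d}$. -}

module Defs where

open import Data.Nat using (ℕ; zero; suc; _+_; _*_; _∸_; _^_; _≤_; _<_; NonZero)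
open import Data.Nat.DivMod using (_/_; _%_)
open import Data.Product using (_×_)
open import Relation.Binary.PropositionalEquality using (_≡_)

-- sum of base-q digits of i (as an integer, not reduced), computed with fuel
-- (fuel ≥ i suffices since i / q < i for i ≥ 1, q ≥ 2)
digitSumAux : (q : ℕ) → .{{_ : NonZero q}} → ℕ → ℕ → ℕ
digitSumAux q zero    i = 0
digitSumAux q (suc f) zero = 0
digitSumAux q (suc f) i@(suc _) = i % q + digitSumAux q f (i / q)

digitSum : (q : ℕ) → .{{_ : NonZero q}} → ℕ → ℕ
digitSum q i = digitSumAux q i i

s : (q : ℕ) → .{{_ : NonZero q}} → ℕ → ℕ
s q i = digitSum q i % q

ω : (q : ℕ) → .{{_ : NonZero q}} → ℕ → ℕ
ω q i = s q i

EqualRun : (q : ℕ) → .{{_ : NonZero q}} → ℕ → ℕ → ℕ → Set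
EqualRun q c d k = ∀ j → j < k → ω q (c + j * d) ≡ ω q c

IsL : (q : ℕ) → .{{_ : NonZero q}} → ℕ → ℕ → ℕ → Set
IsL q c d k = (1 ≤ k) × EqualRun q c d k × (∀ k′ → 1 ≤ k′ → EqualRun q c d k′ → k′ ≤ k)

module Submission where

-- Write q = p + 2, x = q - 1 (the largest digit), N = q ^ n and d = N - 1, and read numbers
-- as three digits in base N:  ⟨ h , m , l ⟩ = l + N (m + N h).  Then c(z) = ⟨ z , y , x ⟩
-- with x + y = N, and adding d = N - 1 moves one unit from the low to the middle digit.
-- So the terms c(z) + j d of the progression are, successively,
--   ⟨ z , y + j , x - j ⟩ (j < x),   ⟨ z + 1 , 0 , 0 ⟩ (j = x),   ⟨ z + 1 , i , d - i ⟩ (j = q + i),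
--   ⟨ z + 1 , d , d ⟩ (j = q + N),   ⟨ z + 2 , v , d - 1 - v ⟩ (j = q + N + 1 + v).
-- Base-q digit sums add up over these base-N digits, and i + l = d forces s(i) + s(l) = n x
-- (digitwise complement).  Independently of z, the terms with j₁ = q + N + 1 and N + 2q have
-- digit sums differing by exactly x, which is nonzero mod q, so every run stops by index N + 2q.
-- When q ∣ n, n x vanishes mod q, and for z = q every term before index N + 2q has digit sum
-- ≡ 2 (mod q); hence the run from c(q) has length exactly N + 2q.

open import Defs
open import Data.Nat using (ℕ; zero; suc; _+_; _*_; _∸_; _^_; _≤_; _<_; NonZero)
open import Data.Nat.Divisibility using (_∣_)
open import Data.Nat.Primality using (Prime)
open import Data.Product using (_×_; Σ; ∃; ∃-syntax; _,_)

open import Data.Nat using (z≤n; s≤s; s≤s⁻¹; s<s⁻¹; _≟_; >-nonZero)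
open import Data.Nat.Properties
open import Data.Nat.DivMod
open import Data.Nat.Divisibility using (∣⇒≤; m∣m*n; ∣m⇒∣m*n)
open import Data.Nat.Primality using (¬prime[0]; ¬prime[1])
open import Data.Nat.Tactic.RingSolver using (solve-∀)
open import Data.Product using (map₂)
open import Data.Sum using (_⊎_; inj₁; inj₂)
open import Data.Empty using (⊥-elim)
open import Relation.Nullary using (¬_; yes; no)
open import Relation.Binary.Definitions using (tri<; tri≈; tri>)
open import Relation.Binary.PropositionalEquality
import Algebra.Properties.CommutativeSemigroup +-commutativeSemigroup as +-CS

locate : ∀ a j → j < a ⊎ j ≡ a ⊎ ∃[ i ] (j ≡ a + suc i)
locate a j with <-cmp j a
... | tri< j<a _ _ = inj₁ j<a
... | tri≈ _ j≡a _ = inj₂ (inj₁ j≡a)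
... | tri> _ _ a<j = inj₂ (inj₂ (j ∸ suc a , sym (trans (+-suc a _) (m+[n∸m]≡n a<j))))

module DigitSums (p : ℕ) where

  q : ℕ
  q = suc (suc p)

  x : ℕ
  x = suc p

  DS : ℕ → ℕ
  DS = digitSum q

  quotient-smaller : ∀ i → suc i / q ≤ i
  quotient-smaller i = s≤s⁻¹ (m/n<m (suc i) q (s≤s (s≤s z≤n)))

  fuel-irrelevant : ∀ f g i → i ≤ f → i ≤ g → digitSumAux q f i ≡ digitSumAux q g i
  fuel-irrelevant zero    zero    _       _         _         = refl
  fuel-irrelevant zero    (suc _) zero    _         _         = refl
  fuel-irrelevant (suc _) zero    zero    _         _         = refl
  fuel-irrelevant (suc _) (suc _) zero    _         _         = refl
  fuel-irrelevant (suc f) (suc g) (suc i) (s≤s i≤f) (s≤s i≤g) =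
    cong (suc i % q +_) (fuel-irrelevant f g (suc i / q)
      (≤-trans (quotient-smaller i) i≤f) (≤-trans (quotient-smaller i) i≤g))

  DS-unfold : ∀ i → DS i ≡ i % q + DS (i / q)
  DS-unfold zero    = refl
  DS-unfold (suc i) = cong (suc i % q +_)
    (fuel-irrelevant i (suc i / q) (suc i / q) (quotient-smaller i) ≤-refl)

  split-digit : ∀ i → i ≡ i % q + q * (i / q)
  split-digit i = trans (m≡m%n+[m/n]*n i q) (cong (i % q +_) (*-comm (i / q) q))

  DS-digit : ∀ r a → r < q → DS (r + q * a) ≡ r + DS a
  DS-digit r a r<q = begin
    DS (r + q * a)                          ≡⟨ DS-unfold (r + q * a) ⟩
    (r + q * a) % q + DS ((r + q * a) / q)  ≡⟨ cong₂ (λ u v → u + DS v) last-digit rest ⟩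
    r + DS a                                ∎
    where
    open ≡-Reasoning
    last-digit : (r + q * a) % q ≡ r
    last-digit = trans (%-remove-+ʳ r (m∣m*n a)) (m<n⇒m%n≡m r<q)
    rest : (r + q * a) / q ≡ a
    rest = trans (+-distrib-/-∣ʳ r (m∣m*n a))
      (cong₂ _+_ (m<n⇒m/n≡0 r<q) (trans (/-congˡ (*-comm q a)) (m*n/n≡m a q)))

  DS-small : ∀ r → r < q → DS r ≡ r
  DS-small r r<q = begin
    DS r            ≡⟨ cong DS (sym (trans (cong (r +_) (*-zeroʳ q)) (+-identityʳ r))) ⟩
    DS (r + q * 0)  ≡⟨ DS-digit r 0 r<q ⟩
    r + 0           ≡⟨ +-identityʳ r ⟩
    r               ∎
    where open ≡-Reasoning

  DS-q : DS q ≡ 1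
  DS-q = trans (cong DS (sym (*-identityʳ q))) (DS-digit 0 1 (s≤s z≤n))

  DS-1+q : DS (suc q) ≡ 2
  DS-1+q = trans (cong (λ t → DS (suc t)) (sym (*-identityʳ q))) (DS-digit 1 1 (s≤s (s≤s z≤n)))

  DS-blocks : ∀ k b a → b < q ^ k → DS (b + q ^ k * a) ≡ DS b + DS a
  DS-blocks zero    zero    a _ = cong DS (+-identityʳ a)
  DS-blocks zero    (suc _) _ (s≤s ())
  DS-blocks (suc k) b       a b<qᵏ⁺¹ = begin
    DS (b + q ^ suc k * a)                ≡⟨ cong DS regroup ⟩
    DS (b % q + q * (b / q + q ^ k * a))  ≡⟨ DS-digit (b % q) (b / q + q ^ k * a) (m%n<n b q) ⟩
    b % q + DS (b / q + q ^ k * a)        ≡⟨ cong (b % q +_) (DS-blocks k (b / q) a quotient<) ⟩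
    b % q + (DS (b / q) + DS a)           ≡⟨ sym (+-assoc (b % q) _ _) ⟩
    b % q + DS (b / q) + DS a             ≡⟨ cong (_+ DS a) (sym (DS-unfold b)) ⟩
    DS b + DS a                           ∎
    where
    open ≡-Reasoning
    quotient< : b / q < q ^ k
    quotient< = m<n*o⇒m/o<n (subst (b <_) (*-comm q (q ^ k)) b<qᵏ⁺¹)
    regroup : b + q ^ suc k * a ≡ b % q + q * (b / q + q ^ k * a)
    regroup = begin
      b + q * q ^ k * a                      ≡⟨ cong₂ _+_ (split-digit b) (*-assoc q (q ^ k) a) ⟩
      b % q + q * (b / q) + q * (q ^ k * a)  ≡⟨ +-assoc (b % q) _ _ ⟩
      b % q + (q * (b / q) + q * (q ^ k * a)) ≡⟨ cong (b % q +_) (sym (*-distribˡ-+ q (b / q) _)) ⟩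
      b % q + q * (b / q + q ^ k * a)        ∎

  -- Digitwise complement: every i < q ^ k has a partner l with i + l + 1 = q ^ k whose
  -- digits are the complements x - (digit of i), so the digit sums add up to k x.
  complement-exists : ∀ k i → i < q ^ k → ∃[ l ] (suc (i + l) ≡ q ^ k × DS i + DS l ≡ k * x)
  complement-exists zero    zero    _ = 0 , refl , refl
  complement-exists zero    (suc _) (s≤s ())
  complement-exists (suc k) i i<qᵏ⁺¹
    with complement-exists k (i / q) (m<n*o⇒m/o<n (subst (i <_) (*-comm q (q ^ k)) i<qᵏ⁺¹))
  ... | l , total , digit-total = x ∸ r + q * l , total′ , digit-total′
    where
    open ≡-Reasoning
    r = i % q
    r+[x∸r] : r + (x ∸ r) ≡ x
    r+[x∸r] = m+[n∸m]≡n (s≤s⁻¹ (m%n<n i q))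
    total′ : suc (i + (x ∸ r + q * l)) ≡ q ^ suc k
    total′ = begin
      suc (i + (x ∸ r + q * l))                ≡⟨ cong (λ t → suc (t + (x ∸ r + q * l))) (split-digit i) ⟩
      suc (r + q * (i / q) + (x ∸ r + q * l))  ≡⟨ cong suc (+-CS.interchange r (q * (i / q)) (x ∸ r) (q * l)) ⟩
      suc (r + (x ∸ r) + (q * (i / q) + q * l)) ≡⟨ cong₂ (λ u v → suc (u + v)) r+[x∸r] (sym (*-distribˡ-+ q (i / q) l)) ⟩
      suc (x + q * (i / q + l))                ≡⟨ sym (*-suc q (i / q + l)) ⟩
      q * suc (i / q + l)                      ≡⟨ cong (q *_) total ⟩
      q * q ^ k                                ∎
    digit-total′ : DS i + DS (x ∸ r + q * l) ≡ suc k * x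
    digit-total′ = begin
      DS i + DS (x ∸ r + q * l)          ≡⟨ cong₂ _+_ (DS-unfold i) (DS-digit (x ∸ r) l (s≤s (m∸n≤m x r))) ⟩
      r + DS (i / q) + (x ∸ r + DS l)    ≡⟨ +-CS.interchange r _ (x ∸ r) _ ⟩
      r + (x ∸ r) + (DS (i / q) + DS l)  ≡⟨ cong₂ _+_ r+[x∸r] digit-total ⟩
      x + k * x                          ∎

  -- If i + l + 1 = q ^ k then s(i) + s(l) = k x: the partner above is unique.
  complement : ∀ k i l → suc (i + l) ≡ q ^ k → DS i + DS l ≡ k * x
  complement k i l total with complement-exists k i (subst (i <_) total (s≤s (m≤m+n i l)))
  ... | l′ , total′ , digit-total′ =
    subst (λ t → DS i + DS t ≡ k * x) (+-cancelˡ-≡ i _ _ (suc-injective (trans total′ (sym total)))) digit-total′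

  digit-shift : ∀ r → r < q → ¬ ((r + x) % q ≡ r)
  digit-shift zero    _   eq = 1+n≢0 (trans (sym (m<n⇒m%n≡m {n = q} (n<1+n x))) eq)
  digit-shift (suc r) r<q eq = 1+n≢n (sym (begin
    r            ≡⟨ sym (m<n⇒m%n≡m (<-trans (n<1+n r) r<q)) ⟩
    r % q        ≡⟨ sym ([m+n]%n≡m%n r q) ⟩
    (r + q) % q  ≡⟨ cong (_% q) (+-suc r x) ⟩
    (suc r + x) % q ≡⟨ eq ⟩
    suc r        ∎))
    where open ≡-Reasoning

  residue-shift : ∀ a → ¬ ((a + x) % q ≡ a % q)
  residue-shift a eq = digit-shift (a % q) (m%n<n a q) (trans (sym reduce) eq)
    where
    open ≡-Reasoning
    reduce : (a + x) % q ≡ (a % q + x) % q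
    reduce = begin
      (a + x) % q                      ≡⟨ cong (λ t → (t + x) % q) (m≡m%n+[m/n]*n a q) ⟩
      (a % q + a / q * q + x) % q      ≡⟨ cong (_% q) (+-CS.xy∙z≈xz∙y (a % q) _ x) ⟩
      (a % q + x + a / q * q) % q      ≡⟨ [m+kn]%n≡m%n (a % q + x) (a / q) q ⟩
      (a % q + x) % q                  ∎

-- In base q the number q + 2 has digit sum 3 (q > 2) resp. 1 (q = 2): in both cases 1 + (2 mod q).
DS-2+q : ∀ p → DigitSums.DS p (2 + DigitSums.q p) ≡ suc (2 % DigitSums.q p)
DS-2+q zero    = refl
DS-2+q (suc p) = begin
  DS (2 + q)      ≡⟨ cong (λ t → DS (2 + t)) (sym (*-identityʳ q)) ⟩
  DS (2 + q * 1)  ≡⟨ DS-digit 2 1 (s≤s (s≤s (s≤s z≤n))) ⟩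
  2 + DS 1        ≡⟨ cong (2 +_) (DS-small 1 (s≤s (s≤s z≤n))) ⟩
  3               ≡⟨ cong suc (sym (m<n⇒m%n≡m {n = q} (s≤s (s≤s (s≤s z≤n))))) ⟩
  suc (2 % q)     ∎
  where
  open ≡-Reasoning
  open DigitSums (suc p)

module Runs (q : ℕ) .{{_ : NonZero q}} (c d : ℕ) where

  OnRun : ℕ → Set
  OnRun j = ω q (c + j * d) ≡ ω q c

  length-at-break : ∀ {k} → 1 ≤ k → EqualRun q c d k → ¬ OnRun k → IsL q c d k
  length-at-break 1≤k run break = 1≤k , run , λ k′ _ run′ → ≮⇒≥ (λ k<k′ → break (run′ _ k<k′))

  first-break : ∀ J → EqualRun q c d J ⊎ ∃[ k ] (k < J × EqualRun q c d k × ¬ OnRun k)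
  first-break zero = inj₁ (λ _ ())
  first-break (suc J) with first-break J
  ... | inj₂ (k , k<J , run , break) = inj₂ (k , m<n⇒m<1+n k<J , run , break)
  ... | inj₁ run with ω q (c + J * d) ≟ ω q c
  ...   | no break = inj₂ (J , n<1+n J , run , break)
  ...   | yes on   = inj₁ extended
    where
    extended : EqualRun q c d (suc J)
    extended j j<1+J with m≤n⇒m<n∨m≡n (s≤s⁻¹ j<1+J)
    ... | inj₁ j<J = run j j<J
    ... | inj₂ refl = on

  bounded-by-break : ∀ J → ¬ OnRun J → ∃[ k ] (IsL q c d k × k ≤ J)
  bounded-by-break J break with first-break (suc J)
  ... | inj₁ run = ⊥-elim (break (run J (n<1+n J)))
  ... | inj₂ (zero , _ , _ , break₀) = ⊥-elim (break₀ (cong (ω q) (+-identityʳ c)))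
  ... | inj₂ (suc k , k<1+J , run , break′) = suc k , length-at-break (s≤s z≤n) run break′ , s≤s⁻¹ k<1+J

module ThreeDigits (d : ℕ) where

  ⟨_,_,_⟩ : ℕ → ℕ → ℕ → ℕ
  ⟨ h , m , l ⟩ = l + suc d * (m + suc d * h)

  advance : ∀ h m i l → ⟨ h , m , i + l ⟩ + i * d ≡ ⟨ h , i + m , l ⟩
  advance h m i l = identity d h m i l
    where
    identity : ∀ d h m i l → i + l + suc d * (m + suc d * h) + i * d ≡ l + suc d * (i + m + suc d * h)
    identity = solve-∀

  carry : ∀ h m l → ⟨ h , m + suc d , l ⟩ ≡ ⟨ suc h , m , l ⟩
  carry h m l = cong (λ t → l + suc d * t) (trans (+-assoc m (suc d) _) (cong (m +_) (sym (*-suc (suc d) h))))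

  refill : ∀ h m → ⟨ h , m , 0 ⟩ + d ≡ ⟨ h , m , d ⟩
  refill h m = +-comm _ d

module Progression (p n : ℕ) (2≤n : 2 ≤ n) where

  open DigitSums p

  d : ℕ
  d = q ^ n ∸ 1

  y : ℕ
  y = q ^ n ∸ x

  c : ℕ → ℕ
  c z = z * q ^ (2 * n) + y * q ^ n + x

  term : ℕ → ℕ → ℕ
  term z j = c z + j * d

  open ThreeDigits d

  -- n ≥ 2 makes q ^ n exceed q, so d = q ^ n - 1 ≥ q and c(z) has the digits z, y, x.
  q<qⁿ : q < q ^ n
  q<qⁿ = ≤-trans (m<m*n q (q * 1) (s≤s (s≤s z≤n))) (^-monoʳ-≤ q 2≤n)

  qⁿ≡1+d : q ^ n ≡ suc d
  qⁿ≡1+d = sym (trans (+-comm 1 d) (m∸n+n≡m (≤-trans (s≤s z≤n) q<qⁿ)))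

  q≤d : q ≤ d
  q≤d = s≤s⁻¹ (subst (q <_) qⁿ≡1+d q<qⁿ)

  digit≤d : ∀ {r} → r < q → r ≤ d
  digit≤d r<q = ≤-trans (<⇒≤ r<q) q≤d

  x+y≡1+d : x + y ≡ suc d
  x+y≡1+d = trans (m+[n∸m]≡n (<⇒≤ (<-trans (n<1+n x) q<qⁿ))) qⁿ≡1+d

  c-digits : ∀ z → c z ≡ ⟨ z , y , x ⟩
  c-digits z = begin
    z * q ^ (2 * n) + y * q ^ n + x      ≡⟨ cong (λ t → z * t + y * q ^ n + x) q²ⁿ≡qⁿqⁿ ⟩
    z * (q ^ n * q ^ n) + y * q ^ n + x  ≡⟨ cong (λ N → z * (N * N) + y * N + x) qⁿ≡1+d ⟩
    z * (suc d * suc d) + y * suc d + x  ≡⟨ identity z y x d ⟩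
    ⟨ z , y , x ⟩                        ∎
    where
    open ≡-Reasoning
    q²ⁿ≡qⁿqⁿ : q ^ (2 * n) ≡ q ^ n * q ^ n
    q²ⁿ≡qⁿqⁿ = trans (^-distribˡ-+-* q n (n + 0)) (cong (λ k → q ^ n * q ^ k) (+-identityʳ n))
    identity : ∀ z y x d → z * (suc d * suc d) + y * suc d + x ≡ x + suc d * (y + suc d * z)
    identity = solve-∀

  DS-three : ∀ h m l → l ≤ d → m ≤ d → DS ⟨ h , m , l ⟩ ≡ DS l + (DS m + DS h)
  DS-three h m l l≤d m≤d = begin
    DS ⟨ h , m , l ⟩                   ≡⟨ cong (λ N → DS (l + N * (m + N * h))) (sym qⁿ≡1+d) ⟩
    DS (l + q ^ n * (m + q ^ n * h))   ≡⟨ DS-blocks n l _ (below l≤d) ⟩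
    DS l + DS (m + q ^ n * h)          ≡⟨ cong (DS l +_) (DS-blocks n m h (below m≤d)) ⟩
    DS l + (DS m + DS h)               ∎
    where
    open ≡-Reasoning
    below : ∀ {b} → b ≤ d → b < q ^ n
    below b≤d = subst (_ <_) (sym qⁿ≡1+d) (s≤s b≤d)

  complement-d : ∀ i l → i + l ≡ d → DS i + DS l ≡ n * x
  complement-d i l i+l≡d = complement n i l (trans (cong suc i+l≡d) (sym qⁿ≡1+d))

  left≤d : ∀ {i l} → i + l ≡ d → i ≤ d
  left≤d {i} {l} i+l≡d = subst (i ≤_) i+l≡d (m≤m+n i l)

  right≤d : ∀ {i l} → i + l ≡ d → l ≤ d
  right≤d {i} {l} i+l≡d = subst (l ≤_) i+l≡d (m≤n+m l i)

  term-shift : ∀ z i j → term z (i + j) ≡ term z i + j * d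
  term-shift z i j = trans (cong (c z +_) (*-distribʳ-+ d i j)) (sym (+-assoc (c z) (i * d) (j * d)))

  term-before-carry : ∀ z j e → j + suc e ≡ x → term z j ≡ ⟨ z , j + y , suc e ⟩
  term-before-carry z j e j+1+e≡x = begin
    c z + j * d                    ≡⟨ cong (_+ j * d) (c-digits z) ⟩
    ⟨ z , y , x ⟩ + j * d          ≡⟨ cong (λ t → ⟨ z , y , t ⟩ + j * d) (sym j+1+e≡x) ⟩
    ⟨ z , y , j + suc e ⟩ + j * d  ≡⟨ advance z y j (suc e) ⟩
    ⟨ z , j + y , suc e ⟩          ∎
    where open ≡-Reasoning

  term-at-carry : ∀ z → term z x ≡ ⟨ suc z , 0 , 0 ⟩
  term-at-carry z = begin
    c z + x * d                ≡⟨ cong (_+ x * d) (c-digits z) ⟩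
    ⟨ z , y , x ⟩ + x * d      ≡⟨ cong (λ t → ⟨ z , y , t ⟩ + x * d) (sym (+-identityʳ x)) ⟩
    ⟨ z , y , x + 0 ⟩ + x * d  ≡⟨ advance z y x 0 ⟩
    ⟨ z , x + y , 0 ⟩          ≡⟨ cong (λ t → ⟨ z , t , 0 ⟩) x+y≡1+d ⟩
    ⟨ z , 0 + suc d , 0 ⟩      ≡⟨ carry z 0 0 ⟩
    ⟨ suc z , 0 , 0 ⟩          ∎
    where open ≡-Reasoning

  term-middle : ∀ z i l → i + l ≡ d → term z (x + suc i) ≡ ⟨ suc z , i , l ⟩
  term-middle z i l i+l≡d = begin
    term z (x + suc i)                 ≡⟨ term-shift z x (suc i) ⟩
    term z x + (d + i * d)             ≡⟨ cong (_+ (d + i * d)) (term-at-carry z) ⟩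
    ⟨ suc z , 0 , 0 ⟩ + (d + i * d)    ≡⟨ sym (+-assoc _ d (i * d)) ⟩
    ⟨ suc z , 0 , 0 ⟩ + d + i * d      ≡⟨ cong (_+ i * d) (refill (suc z) 0) ⟩
    ⟨ suc z , 0 , d ⟩ + i * d          ≡⟨ cong (λ t → ⟨ suc z , 0 , t ⟩ + i * d) (sym i+l≡d) ⟩
    ⟨ suc z , 0 , i + l ⟩ + i * d      ≡⟨ advance (suc z) 0 i l ⟩
    ⟨ suc z , i + 0 , l ⟩              ≡⟨ cong (λ t → ⟨ suc z , t , l ⟩) (+-identityʳ i) ⟩
    ⟨ suc z , i , l ⟩                  ∎
    where open ≡-Reasoning

  term-full : ∀ z → term z (x + suc (suc d)) ≡ ⟨ suc z , d , d ⟩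
  term-full z = begin
    term z (x + suc (suc d))       ≡⟨ cong (term z) (trans (+-suc x (suc d)) (+-comm 1 (x + suc d))) ⟩
    term z (x + suc d + 1)         ≡⟨ term-shift z (x + suc d) 1 ⟩
    term z (x + suc d) + 1 * d     ≡⟨ cong₂ _+_ (term-middle z d 0 (+-identityʳ d)) (*-identityˡ d) ⟩
    ⟨ suc z , d , 0 ⟩ + d          ≡⟨ refill (suc z) d ⟩
    ⟨ suc z , d , d ⟩              ∎
    where open ≡-Reasoning

  term-beyond : ∀ z v l → suc v + l ≡ d → term z (x + suc (suc d + suc v)) ≡ ⟨ suc (suc z) , v , l ⟩
  term-beyond z v l 1+v+l≡d = begin
    term z (x + suc (suc d + suc v))          ≡⟨ cong (term z) (sym (+-assoc x (suc (suc d)) (suc v))) ⟩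
    term z (x + suc (suc d) + suc v)          ≡⟨ term-shift z (x + suc (suc d)) (suc v) ⟩
    term z (x + suc (suc d)) + suc v * d      ≡⟨ cong (_+ suc v * d) (term-full z) ⟩
    ⟨ suc z , d , d ⟩ + suc v * d             ≡⟨ cong (λ t → ⟨ suc z , d , t ⟩ + suc v * d) (sym 1+v+l≡d) ⟩
    ⟨ suc z , d , suc v + l ⟩ + suc v * d     ≡⟨ advance (suc z) d (suc v) l ⟩
    ⟨ suc z , suc v + d , l ⟩                 ≡⟨ cong (λ t → ⟨ suc z , t , l ⟩) (sym (+-suc v d)) ⟩
    ⟨ suc z , v + suc d , l ⟩                 ≡⟨ carry (suc z) v l ⟩
    ⟨ suc (suc z) , v , l ⟩                   ∎
    where open ≡-Reasoning

  DS-before-carry : ∀ z j e → j + suc e ≡ x → DS (term z j) ≡ suc (n * x + DS z)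
  DS-before-carry z j e j+1+e≡x = begin
    DS (term z j)                     ≡⟨ cong DS (term-before-carry z j e j+1+e≡x) ⟩
    DS ⟨ z , j + y , suc e ⟩          ≡⟨ DS-three z (j + y) (suc e) (digit≤d 2+e≤q) (left≤d middle+e≡d) ⟩
    DS (suc e) + (DS (j + y) + DS z)  ≡⟨ cong (_+ (DS (j + y) + DS z)) (DS-small (suc e) 2+e≤q) ⟩
    suc (e + (DS (j + y) + DS z))     ≡⟨ cong suc (sym (+-assoc e _ (DS z))) ⟩
    suc (e + DS (j + y) + DS z)       ≡⟨ cong (λ t → suc (t + DS z)) complement-sum ⟩
    suc (n * x + DS z)                ∎
    where
    open ≡-Reasoning
    2+e≤q : suc (suc e) ≤ q
    2+e≤q = s≤s (subst (suc e ≤_) j+1+e≡x (m≤n+m (suc e) j))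
    middle+e≡d : j + y + e ≡ d
    middle+e≡d = suc-injective (begin
      suc (j + y + e)    ≡⟨ sym (+-suc (j + y) e) ⟩
      j + y + suc e      ≡⟨ +-CS.xy∙z≈xz∙y j y (suc e) ⟩
      j + suc e + y      ≡⟨ cong (_+ y) j+1+e≡x ⟩
      x + y              ≡⟨ x+y≡1+d ⟩
      suc d              ∎)
    complement-sum : e + DS (j + y) ≡ n * x
    complement-sum = begin
      e + DS (j + y)     ≡⟨ +-comm e _ ⟩
      DS (j + y) + e     ≡⟨ cong (DS (j + y) +_) (sym (DS-small e (<-trans (n<1+n e) 2+e≤q))) ⟩
      DS (j + y) + DS e  ≡⟨ complement-d (j + y) e middle+e≡d ⟩
      n * x              ∎

  DS-at-carry : ∀ z → DS (term z x) ≡ DS (suc z)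
  DS-at-carry z = trans (cong DS (term-at-carry z)) (DS-three (suc z) 0 0 z≤n z≤n)

  DS-middle : ∀ z i l → i + l ≡ d → DS (term z (x + suc i)) ≡ n * x + DS (suc z)
  DS-middle z i l i+l≡d = begin
    DS (term z (x + suc i))       ≡⟨ cong DS (term-middle z i l i+l≡d) ⟩
    DS ⟨ suc z , i , l ⟩          ≡⟨ DS-three (suc z) i l (right≤d i+l≡d) (left≤d i+l≡d) ⟩
    DS l + (DS i + DS (suc z))    ≡⟨ +-CS.x∙yz≈yx∙z (DS l) (DS i) _ ⟩
    DS i + DS l + DS (suc z)      ≡⟨ cong (_+ DS (suc z)) (complement-d i l i+l≡d) ⟩
    n * x + DS (suc z)            ∎
    where open ≡-Reasoning

  DS-full : ∀ z → DS (term z (x + suc (suc d))) ≡ n * x + (n * x + DS (suc z))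
  DS-full z = begin
    DS (term z (x + suc (suc d)))  ≡⟨ cong DS (term-full z) ⟩
    DS ⟨ suc z , d , d ⟩           ≡⟨ DS-three (suc z) d d ≤-refl ≤-refl ⟩
    DS d + (DS d + DS (suc z))     ≡⟨ cong (λ t → t + (t + DS (suc z))) (complement-d 0 d refl) ⟩
    n * x + (n * x + DS (suc z))   ∎
    where open ≡-Reasoning

  DS-beyond : ∀ z v l → suc v + l ≡ d →
              DS (term z (x + suc (suc d + suc v))) ≡ DS l + (DS v + DS (suc (suc z)))
  DS-beyond z v l 1+v+l≡d =
    trans (cong DS (term-beyond z v l 1+v+l≡d))
          (DS-three (suc (suc z)) v l (right≤d 1+v+l≡d) (<⇒≤ (left≤d 1+v+l≡d)))

  -- The two indices whose letters can never both agree with the first letter: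
  -- j₁ = q + N + 1 and j₂ = N + 2q, the claimed run length.
  j₁ j₂ : ℕ
  j₁ = x + suc (suc d + suc 0)
  j₂ = x + suc (suc d + suc x)

  j₁<j₂ : j₁ < j₂
  j₁<j₂ = +-monoʳ-< x (s≤s (+-monoʳ-< (suc d) (s≤s (s≤s z≤n))))

  j₂≡qⁿ+2q : j₂ ≡ q ^ n + 2 * q
  j₂≡qⁿ+2q = trans (identity p d) (cong (_+ 2 * q) (sym qⁿ≡1+d))
    where
    identity : ∀ p d → suc p + suc (suc d + suc (suc p)) ≡ suc d + 2 * suc (suc p)
    identity = solve-∀

  DS-j₂ : ∀ z → DS (term z j₂) ≡ DS (term z j₁) + x
  DS-j₂ z = begin
    DS (term z j₂)                     ≡⟨ DS-beyond z x l₂ 1+x+l₂≡d ⟩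
    DS l₂ + (DS x + DS (suc (suc z)))  ≡⟨ cong₂ (λ a b → a + (b + DS (suc (suc z)))) same-low (DS-small x (n<1+n x)) ⟩
    DS l₁ + (x + DS (suc (suc z)))     ≡⟨ +-CS.x∙yz≈xz∙y (DS l₁) x _ ⟩
    DS l₁ + DS (suc (suc z)) + x       ≡⟨ cong (_+ x) (sym (DS-beyond z 0 l₁ 1+l₁≡d)) ⟩
    DS (term z j₁) + x                 ∎
    where
    open ≡-Reasoning
    l₁ l₂ : ℕ
    l₁ = d ∸ 1
    l₂ = d ∸ q
    1+l₁≡d : 1 + l₁ ≡ d
    1+l₁≡d = m+[n∸m]≡n (≤-trans (s≤s z≤n) q≤d)
    1+x+l₂≡d : suc x + l₂ ≡ d
    1+x+l₂≡d = m+[n∸m]≡n q≤d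
    same-low : DS l₂ ≡ DS l₁
    same-low = suc-injective (trans (cong (_+ DS l₂) (sym DS-q))
      (trans (complement-d q l₂ 1+x+l₂≡d) (sym (complement-d 1 l₁ 1+l₁≡d))))

  j₁<qⁿ+2q : j₁ < q ^ n + 2 * q
  j₁<qⁿ+2q = subst (j₁ <_) j₂≡qⁿ+2q j₁<j₂

  j₁-or-j₂-breaks : ∀ z → ω q (term z j₁) ≡ ω q (c z) → ¬ (ω q (term z j₂) ≡ ω q (c z))
  j₁-or-j₂-breaks z on₁ on₂ =
    residue-shift (DS (term z j₁)) (trans (cong (_% q) (sym (DS-j₂ z))) (trans on₂ (sym on₁)))

  run-bounded : ∀ z → ∃[ k ] (IsL q (c z) d k × k ≤ q ^ n + 2 * q)
  run-bounded z with ω q (term z j₁) ≟ ω q (c z)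
  ... | no break₁ = map₂ (map₂ (λ k≤j₁ → ≤-trans k≤j₁ (<⇒≤ j₁<qⁿ+2q)))
                         (Runs.bounded-by-break q (c z) d j₁ break₁)
  ... | yes on₁   = map₂ (map₂ (λ k≤j₂ → ≤-trans k≤j₂ (≤-reflexive j₂≡qⁿ+2q)))
                         (Runs.bounded-by-break q (c z) d j₂ (j₁-or-j₂-breaks z on₁))

  module _ (q∣n : q ∣ n) where

    absorb : ∀ a → (n * x + a) % q ≡ a % q
    absorb a = %-remove-+ˡ a (∣m⇒∣m*n x q∣n)

    residue-before-carry : ∀ j e → j + suc e ≡ x → ω q (term q j) ≡ 2 % q
    residue-before-carry j e j+1+e≡x = begin
      DS (term q j) % q       ≡⟨ cong (_% q) (DS-before-carry q j e j+1+e≡x) ⟩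
      suc (n * x + DS q) % q  ≡⟨ cong (λ t → suc (n * x + t) % q) DS-q ⟩
      suc (n * x + 1) % q     ≡⟨ cong (_% q) (sym (+-suc (n * x) 1)) ⟩
      (n * x + 2) % q         ≡⟨ absorb 2 ⟩
      2 % q                   ∎
      where open ≡-Reasoning

    residue-at-carry : ω q (term q x) ≡ 2 % q
    residue-at-carry = cong (_% q) (trans (DS-at-carry q) DS-1+q)

    residue-middle : ∀ i l → i + l ≡ d → ω q (term q (x + suc i)) ≡ 2 % q
    residue-middle i l i+l≡d =
      trans (cong (_% q) (trans (DS-middle q i l i+l≡d) (cong (n * x +_) DS-1+q))) (absorb 2)

    residue-full : ω q (term q (x + suc (suc d))) ≡ 2 % q
    residue-full =
      trans (cong (_% q) (trans (DS-full q) (cong (λ t → n * x + (n * x + t)) DS-1+q)))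
            (trans (absorb (n * x + 2)) (absorb 2))

    residue-beyond : ∀ v l → v < x → suc v + l ≡ d → ω q (term q (x + suc (suc d + suc v))) ≡ 2 % q
    residue-beyond v l v<x 1+v+l≡d = begin
      DS (term q (x + suc (suc d + suc v))) % q  ≡⟨ cong (_% q) (DS-beyond q v l 1+v+l≡d) ⟩
      (DS l + (DS v + DS (suc (suc q)))) % q      ≡⟨ cong (_% q) digit-sum ⟩
      (n * x + 2 % q) % q                         ≡⟨ absorb (2 % q) ⟩
      2 % q % q                                   ≡⟨ m%n%n≡m%n 2 q ⟩
      2 % q                                       ∎
      where
      open ≡-Reasoning
      1+v<q : suc v < q
      1+v<q = s≤s v<x
      rearrange : ∀ a b c → a + (b + suc c) ≡ suc b + a + c
      rearrange = solve-∀
      digit-sum : DS l + (DS v + DS (suc (suc q))) ≡ n * x + 2 % q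
      digit-sum = begin
        DS l + (DS v + DS (suc (suc q)))  ≡⟨ cong₂ (λ a b → DS l + (a + b)) (DS-small v (<-trans (n<1+n v) 1+v<q)) (DS-2+q p) ⟩
        DS l + (v + suc (2 % q))          ≡⟨ rearrange (DS l) v (2 % q) ⟩
        suc v + DS l + 2 % q              ≡⟨ cong (λ t → t + DS l + 2 % q) (sym (DS-small (suc v) 1+v<q)) ⟩
        DS (suc v) + DS l + 2 % q         ≡⟨ cong (_+ 2 % q) (complement-d (suc v) l 1+v+l≡d) ⟩
        n * x + 2 % q                     ∎

    residue : ∀ j → j < q ^ n + 2 * q → ω q (term q j) ≡ 2 % q
    residue j j<B with locate x j
    ... | inj₁ j<x = residue-before-carry j (x ∸ suc j) (trans (+-suc j _) (m+[n∸m]≡n j<x))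
    ... | inj₂ (inj₁ refl) = residue-at-carry
    ... | inj₂ (inj₂ (i , refl)) with locate (suc d) i
    ...   | inj₁ i<1+d = residue-middle i (d ∸ i) (m+[n∸m]≡n (s≤s⁻¹ i<1+d))
    ...   | inj₂ (inj₁ refl) = residue-full
    ...   | inj₂ (inj₂ (v , refl)) = residue-beyond v (d ∸ suc v) v<x (m+[n∸m]≡n (digit≤d (s≤s v<x)))
      where
      v<x : v < x
      v<x = s<s⁻¹ (+-cancelˡ-< (suc d) _ _ (s<s⁻¹ (+-cancelˡ-< x _ _ (subst (x + suc (suc d + suc v) <_) (sym j₂≡qⁿ+2q) j<B))))

    run-exact : IsL q (c q) d (q ^ n + 2 * q)
    run-exact = Runs.length-at-break q (c q) d (≤-<-trans z≤n j₁<qⁿ+2q) constant break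
      where
      first : ω q (c q) ≡ 2 % q
      first = trans (cong (ω q) (sym (+-identityʳ (c q)))) (residue 0 (≤-<-trans z≤n j₁<qⁿ+2q))
      constant : EqualRun q (c q) d (q ^ n + 2 * q)
      constant j j<B = trans (residue j j<B) (sym first)
      break : ¬ (ω q (term q (q ^ n + 2 * q)) ≡ ω q (c q))
      break on = j₁-or-j₂-breaks q (constant j₁ j₁<qⁿ+2q) (trans (cong (λ j → ω q (term q j)) j₂≡qⁿ+2q) on)

lemma3 : (q : ℕ) → .{{_ : NonZero q}} → Prime q → (n : ℕ) → 1 ≤ n → q ∣ n →
         let d = q ^ n ∸ 1
             y = q ^ n ∸ (q ∸ 1)
             x = q ∸ 1
             c = λ (z : ℕ) → z * q ^ (2 * n) + y * q ^ n + x
         in (∀ z → ∃[ k ] (IsL q (c z) d k × k ≤ q ^ n + 2 * q))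
            × (∃[ z ] IsL q (c z) d (q ^ n + 2 * q))
lemma3 zero          prime-0 = ⊥-elim (¬prime[0] prime-0)
lemma3 (suc zero)    prime-1 = ⊥-elim (¬prime[1] prime-1)
lemma3 (suc (suc p)) _ n 1≤n q∣n = run-bounded , (suc (suc p) , run-exact q∣n)
  where
  2≤n : 2 ≤ n
  2≤n = ≤-trans (s≤s (s≤s z≤n)) (∣⇒≤ {{>-nonZero 1≤n}} q∣n)
  open Progression p n 2≤n
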